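{- Let $n\ge1$ and let $\alpha=(i,j,A,B)$ and $\alpha'=(i',j',A',B')$ be two exchangeable wiggly arcs. Then every wiggly arc compatible with both $\alpha$ and $\alpha'$ is also compatible with the wiggly arcs $\beta$ and $\beta'$ defined as follows: (1) if $\alpha$ and $\alpha'$ are non pointed with $j=i'$: $\beta=(i,j',A\cup A',B\cup B'\cup\{j\})$ and $\beta'=(i,j',A\cup A'\cup\{j\},B\cup B')$; (2) if $\alpha$ and $\alpha'$ are crossing and $\alpha$ crosses $\alpha'$ from north-west to south-east: $\beta=(i',j,\ I\setminus(B\cup B'),\ I\cap(B\cup B'))$ with $I=\{i'+1,\dots,j-1\}$, and $\beta'=(i,j',\ J\cap(A\cup A'),\ J\setminus(A\cup A'))$ with $J=\{i+1,\dots,j'-1\}$. By exchanging the roles of $\alpha$ and $\alpha'$, the analogous statements hold when $\alpha,\alpha'$ are non pointed with $j'=i$, or when $\alpha$ crosses $\alpha'$ from south-east to north-west.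
   Context: Points $0,\dots,n+1$ on a horizontal line. A wiggly arc is $(i,j,A,B)$ with $0\le i<j\le n+1$ and $A,B$ a partition of $\{i+1,\dots,j-1\}$ (abscissa-monotone curve from $i$ to $j$ passing above $A$, below $B$); external arcs $(0,n+1,[n],\varnothing)$, $(0,n+1,\varnothing,[n])$. Arcs $(i,j,A,B)$, $(i',j',A',B')$ are non pointed if $i=j'$ or $i'=j$; crossing if $(A\cap B')\cup(\{i,j\}\cap B')\cup(A\cap\{i',j'\})\ne\varnothing\ne(A'\cap B)\cup(\{i',j'\}\cap B)\cup(A'\cap\{i,j\})$; compatible if neither. $\alpha$ crosses $\alpha'$ from north-west to south-east if there exist $1\le k<\ell\le n$ with $k\in(A\cap B')\cup(\{i\}\cap B')\cup(A\cap\{i'\})$ and $\ell\in(A'\cap B)\cup(\{j'\}\cap B)\cup(A'\cap\{j\})$. A wiggly pseudotriangulation is an inclusion-maximal set of pairwise compatible arcs containing both external arcs. Two distinct wiggly arcs $\alpha,\alpha'$ are exchangeable if there exist wiggly pseudotriangulations $T\ni\alpha$ and $T'\ni\alpha'$ with $T\setminus\{\alpha\}=T'\setminus\{\alpha'\}$. -}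

module Defs where

open import Data.Nat as ℕ using (ℕ; suc; _≤_)
open import Data.Fin as Fin using (Fin; toℕ; _<?_)
open import Data.Fin.Subset using (Subset; _∈_; _∪_; _∩_; ∁; ⁅_⁆) renaming (⊥ to ∅)
open import Data.Vec using (tabulate)
open import Data.Bool using (_∧_)
open import Data.Product using (Σ; _×_; ∃; ∃-syntax)
open import Data.Sum using (_⊎_)
open import Relation.Nullary using (¬_; does)
open import Relation.Binary.PropositionalEquality using (_≡_; _≢_)
open import Function.Bundles using (_⇔_)
open import Level using (0ℓ)

Pt : ℕ → Set
Pt n = Fin (suc (suc n))

record Arc (n : ℕ) : Set where
  constructor arc
  field
    i : Pt n
    j : Pt n
    A : Subset (suc (suc n))
    B : Subset (suc (suc n))
open Arc public

interval : ∀ {n} → Pt n → Pt n → Subset (suc (suc n))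
interval a b = tabulate (λ k → does (a <? k) ∧ does (k <? b))

IsWigglyArc : ∀ {n} → Arc n → Set
IsWigglyArc α =
  (i α Fin.< j α) ×
  (∀ k → ((k ∈ A α ⊎ k ∈ B α) ⇔ ((i α Fin.< k) × (k Fin.< j α)))) ×
  (∀ k → ¬ (k ∈ A α × k ∈ B α))

extUp : ∀ n → Arc n
extUp n = arc Fin.zero (Fin.fromℕ (suc n)) (interval Fin.zero (Fin.fromℕ (suc n)))
              ∅

extDown : ∀ n → Arc n
extDown n = arc Fin.zero (Fin.fromℕ (suc n))
              ∅
              (interval Fin.zero (Fin.fromℕ (suc n)))

NonPointed : ∀ {n} → Arc n → Arc n → Set
NonPointed α α' = (i α ≡ j α') ⊎ (i α' ≡ j α)

HalfCross : ∀ {n} → Arc n → Arc n → Set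
HalfCross α α' = ∃[ k ]
  ((k ∈ A α × k ∈ B α') ⊎
   (((k ≡ i α) ⊎ (k ≡ j α)) × k ∈ B α') ⊎
   (k ∈ A α × ((k ≡ i α') ⊎ (k ≡ j α'))))

Crossing : ∀ {n} → Arc n → Arc n → Set
Crossing α α' = HalfCross α α' × HalfCross α' α

Compatible : ∀ {n} → Arc n → Arc n → Set
Compatible α α' = ¬ NonPointed α α' × ¬ Crossing α α'

CrossesNWSE : ∀ {n} → Arc n → Arc n → Set
CrossesNWSE {n} α α' = Σ (Pt n) λ k → Σ (Pt n) λ ℓ →
  (1 ≤ toℕ k) × (k Fin.< ℓ) × (toℕ ℓ ≤ n) ×
  ((k ∈ A α × k ∈ B α') ⊎ ((k ≡ i α) × k ∈ B α') ⊎ (k ∈ A α × (k ≡ i α'))) ×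
  ((ℓ ∈ A α' × ℓ ∈ B α) ⊎ ((ℓ ≡ j α') × ℓ ∈ B α) ⊎ (ℓ ∈ A α' × (ℓ ≡ j α)))

ArcSet : ℕ → Set₁
ArcSet n = Arc n → Set

PairwiseCompatible : ∀ {n} → ArcSet n → Set
PairwiseCompatible S = ∀ α β → S α → S β → Compatible α β

IsCompatibleSet : ∀ {n} → ArcSet n → Set
IsCompatibleSet {n} S =
  (∀ α → S α → IsWigglyArc α) × S (extUp n) × S (extDown n) × PairwiseCompatible S

IsPseudotriangulation : ∀ {n} → ArcSet n → Set₁
IsPseudotriangulation {n} T =
  IsCompatibleSet T ×
  (∀ (S : ArcSet n) → IsCompatibleSet S → (∀ α → T α → S α) → ∀ α → S α → T α)

Exchangeable : ∀ {n} → Arc n → Arc n → Set₁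
Exchangeable {n} α α' =
  α ≢ α' ×
  Σ (ArcSet n) λ T → Σ (ArcSet n) λ T' →
    IsPseudotriangulation T × IsPseudotriangulation T' × T α × T' α' ×
    (∀ γ → ((T γ × γ ≢ α) ⇔ (T' γ × γ ≢ α')))

β₁ : ∀ {n} → Arc n → Arc n → Arc n
β₁ α α' = arc (i α) (j α') (A α ∪ A α') ((B α ∪ B α') ∪ ⁅ j α ⁆)

β₁' : ∀ {n} → Arc n → Arc n → Arc n
β₁' α α' = arc (i α) (j α') ((A α ∪ A α') ∪ ⁅ j α ⁆) (B α ∪ B α')

β₂ : ∀ {n} → Arc n → Arc n → Arc n
β₂ α α' = arc (i α') (j α) (I ∩ ∁ (B α ∪ B α')) (I ∩ (B α ∪ B α'))
  where I = interval (i α') (j α)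

β₂' : ∀ {n} → Arc n → Arc n → Arc n
β₂' α α' = arc (i α) (j α') (J ∩ (A α ∪ A α')) (J ∩ ∁ (A α ∪ A α'))
  where J = interval (i α) (j α')

{-# OPTIONS --safe #-}
module Submission where

-- Over a point k a wiggly arc passes above k, below k, through k (at an endpoint) or not at all, and two
-- arcs cross exactly when each passes strictly above the other over some point.
--
-- β₁ runs along α and then along α' through their common endpoint j = i'. An arc γ compatible with α
-- and α' but crossing β₁ would lie above one of them and below the other, so it would pass over j, where
-- it is above both or below both.
--
-- β₂ passes below every point that α or α' passes below. An arc γ compatible with α and α' but crossing
-- β₂ would lie above one of them and below the other, on the near side of a witness of the crossing of α
-- and α'. It cannot pass over that witness, so it stops before it, and over its endpoint α' is above α:
-- then α' also crosses α from north-west to south-east. Two crossings in opposite directions contain a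
-- zigzag (P above Q over r, below over s, above over t, with r < s < t), which exchangeability forbids:
-- cutting P at the last such s gives an arc compatible with P and with every arc compatible with both P
-- and Q, but not with Q. By maximality that arc belongs to the pseudotriangulation containing P, and it
-- survives the exchange into the one containing Q, which is impossible.
--
-- β₁' and β₂' follow by mirroring, i.e. by swapping A and B throughout.

open import Defs
open import Data.Bool using (_∧_)
open import Data.Bool.Properties using (T-≡; T-∧)
open import Data.Empty using (⊥; ⊥-elim)
open import Data.Fin.Subset using (_∈_; _∉_; _∪_; _∩_; ∁; ⁅_⁆)
open import Data.Fin.Subset.Properties
  using (_∈?_; ∪-comm; x∈p∩q⁺; x∈p∩q⁻; x∈p∪q⁺; x∈p∪q⁻; x∈∁p⇒x∉p; x∈⁅y⁆⇒x≡y)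
open import Data.Nat using (ℕ)
import Data.Product as Product
open import Data.Product using (_×_; _,_; -,_; proj₁; proj₂; ∃; ∃₂)
open import Data.Sum as Sum using (_⊎_; inj₁; inj₂; [_,_]′)
import Data.Vec as Vec
open import Data.Vec.Properties using (lookup∘tabulate; []=⇒lookup; lookup⇒[]=)
open import Function using (_∘_; id)
open import Function.Bundles using (Equivalence; mk⇔)
open import Function.Properties.Equivalence using () renaming (sym to ⇔-sym)
open import Induction.WellFounded using (Acc; acc)
open import Relation.Binary.Definitions using (tri<; tri≈; tri>)
open import Relation.Binary.PropositionalEquality using (_≡_; refl; sym; trans; cong; subst; subst₂; _≢_)
open import Relation.Nullary using (¬_; yes; no; does; ¬¬-excluded-middle)

-- The orders of Fin are opened only in here: the statement at the end uses the _≤_ of ℕ.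
module WigglyArcs where

  open import Data.Fin.Base using (toℕ; _<_; _≤_; _>_)
  open import Data.Fin.Induction using (>-wellFounded)
  open import Data.Fin.Properties using (_<?_; _≤?_; _≟_)
  import Data.Fin.Properties as Fin
  import Data.Nat.Properties as ℕ

  private variable
    n : ℕ
    a b c γ δ P Q α α' : Arc n
    k ℓ p q r s t : Pt n

  record Interior (a : Arc n) (k : Pt n) : Set where
    constructor interior
    field
      start<k : i a < k
      k<end   : k < j a

  record InSpan (a : Arc n) (k : Pt n) : Set where
    constructor inSpan
    field
      start≤k : i a ≤ k
      k≤end   : k ≤ j a

  open Interior
  open InSpan

  Endpoint : Arc n → Pt n → Set
  Endpoint a k = k ≡ i a ⊎ k ≡ j a

  i<j : IsWigglyArc a → i a < j a
  i<j = proj₁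

  ∈A⇒Interior : IsWigglyArc a → k ∈ A a → Interior a k
  ∈A⇒Interior {k = k} (_ , span , _) k∈A =
    let i<k , k<j = Equivalence.to (span k) (inj₁ k∈A) in interior i<k k<j

  ∈B⇒Interior : IsWigglyArc a → k ∈ B a → Interior a k
  ∈B⇒Interior {k = k} (_ , span , _) k∈B =
    let i<k , k<j = Equivalence.to (span k) (inj₂ k∈B) in interior i<k k<j

  Interior⇒∈A⊎∈B : IsWigglyArc a → Interior a k → k ∈ A a ⊎ k ∈ B a
  Interior⇒∈A⊎∈B {k = k} (_ , span , _) (interior i<k k<j) = Equivalence.from (span k) (i<k , k<j)

  ∈A⇒∉B : IsWigglyArc a → k ∈ A a → k ∉ B a
  ∈A⇒∉B {k = k} (_ , _ , disjoint) k∈A k∈B = disjoint k (k∈A , k∈B)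

  ∉B⇒∈A : IsWigglyArc a → Interior a k → k ∉ B a → k ∈ A a
  ∉B⇒∈A w a∋k k∉B = [ id , ⊥-elim ∘ k∉B ]′ (Interior⇒∈A⊎∈B w a∋k)

  Interior⇒InSpan : Interior a k → InSpan a k
  Interior⇒InSpan (interior i<k k<j) = inSpan (ℕ.<⇒≤ i<k) (ℕ.<⇒≤ k<j)

  ∈A⇒InSpan : IsWigglyArc a → k ∈ A a → InSpan a k
  ∈A⇒InSpan w = Interior⇒InSpan ∘ ∈A⇒Interior w

  ∈B⇒InSpan : IsWigglyArc a → k ∈ B a → InSpan a k
  ∈B⇒InSpan w = Interior⇒InSpan ∘ ∈B⇒Interior w

  Endpoint⇒InSpan : IsWigglyArc a → Endpoint a k → InSpan a k
  Endpoint⇒InSpan w (inj₁ refl) = inSpan ℕ.≤-refl (ℕ.<⇒≤ (i<j w))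
  Endpoint⇒InSpan w (inj₂ refl) = inSpan (ℕ.<⇒≤ (i<j w)) ℕ.≤-refl

  Interior⇒¬Endpoint : Interior a k → ¬ Endpoint a k
  Interior⇒¬Endpoint (interior i<k _) (inj₁ refl) = ℕ.<-irrefl refl i<k
  Interior⇒¬Endpoint (interior _ k<j) (inj₂ refl) = ℕ.<-irrefl refl k<j

  InSpan⇒¬beyond : InSpan a k → ¬ (k < i a ⊎ j a < k)
  InSpan⇒¬beyond (inSpan i≤k _) (inj₁ k<i) = ℕ.<-irrefl refl (ℕ.<-≤-trans k<i i≤k)
  InSpan⇒¬beyond (inSpan _ k≤j) (inj₂ j<k) = ℕ.<-irrefl refl (ℕ.<-≤-trans j<k k≤j)

  InSpan⇒Interior : InSpan a r → InSpan a t → r < s → s < t → Interior a s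
  InSpan⇒Interior a∋r a∋t r<s s<t = interior (ℕ.≤-<-trans (start≤k a∋r) r<s) (ℕ.<-≤-trans s<t (k≤end a∋t))

  data Height : Set where
    off lo mid hi : Height

  data _≻_ : Height → Height → Set where
    hi≻mid : hi ≻ mid
    hi≻lo  : hi ≻ lo
    mid≻lo : mid ≻ lo

  private variable
    h h' : Height

  ≻-asym : h ≻ h' → ¬ h' ≻ h
  ≻-asym hi≻mid ()
  ≻-asym hi≻lo  ()
  ≻-asym mid≻lo ()

  ≻-cotrans : h ≻ h' → ∀ h″ → h″ ≢ off → h ≻ h″ ⊎ h″ ≻ h'
  ≻-cotrans _      off h″≢off = ⊥-elim (h″≢off refl)
  ≻-cotrans hi≻mid lo  _      = inj₁ hi≻lo
  ≻-cotrans hi≻mid mid _      = inj₁ hi≻mid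
  ≻-cotrans hi≻mid hi  _      = inj₂ hi≻mid
  ≻-cotrans hi≻lo  lo  _      = inj₁ hi≻lo
  ≻-cotrans hi≻lo  mid _      = inj₁ hi≻mid
  ≻-cotrans hi≻lo  hi  _      = inj₂ hi≻lo
  ≻-cotrans mid≻lo lo  _      = inj₁ mid≻lo
  ≻-cotrans mid≻lo mid _      = inj₂ mid≻lo
  ≻-cotrans mid≻lo hi  _      = inj₂ hi≻lo

  data HeightAt (a : Arc n) (k : Pt n) : Height → Set where
    passes-above : k ∈ A a → HeightAt a k hi
    passes-below : k ∈ B a → HeightAt a k lo
    endpoint     : Endpoint a k → HeightAt a k mid
    beyond       : k < i a ⊎ j a < k → HeightAt a k off

  heightAt : IsWigglyArc a → ∀ k → ∃ (HeightAt a k)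
  heightAt {a = a} w k with k ∈? A a | k ∈? B a | k ≟ i a | k ≟ j a | k <? i a | j a <? k
  ... | yes k∈A | _       | _       | _       | _       | _       = hi , passes-above k∈A
  ... | no _    | yes k∈B | _       | _       | _       | _       = lo , passes-below k∈B
  ... | no _    | no _    | yes k≡i | _       | _       | _       = mid , endpoint (inj₁ k≡i)
  ... | no _    | no _    | no _    | yes k≡j | _       | _       = mid , endpoint (inj₂ k≡j)
  ... | no _    | no _    | no _    | no _    | yes k<i | _       = off , beyond (inj₁ k<i)
  ... | no _    | no _    | no _    | no _    | no _    | yes j<k = off , beyond (inj₂ j<k)
  ... | no k∉A  | no k∉B  | no k≢i  | no k≢j  | no k≮i  | no j≮k  =
    ⊥-elim ([ k∉A , k∉B ]′ (Interior⇒∈A⊎∈B w (interior i<k k<j)))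
    where
    i<k : i a < k
    i<k = Fin.≤∧≢⇒< (ℕ.≮⇒≥ k≮i) (k≢i ∘ sym)
    k<j : k < j a
    k<j = Fin.≤∧≢⇒< (ℕ.≮⇒≥ j≮k) k≢j

  heightAt-unique : IsWigglyArc a → HeightAt a k h → HeightAt a k h' → h ≡ h'
  heightAt-unique w (passes-above _)   (passes-above _)   = refl
  heightAt-unique w (passes-below _)   (passes-below _)   = refl
  heightAt-unique w (endpoint _)       (endpoint _)       = refl
  heightAt-unique w (beyond _)         (beyond _)         = refl
  heightAt-unique w (passes-above k∈A) (passes-below k∈B) = ⊥-elim (∈A⇒∉B w k∈A k∈B)
  heightAt-unique w (passes-below k∈B) (passes-above k∈A) = ⊥-elim (∈A⇒∉B w k∈A k∈B)
  heightAt-unique w (passes-above k∈A) (endpoint end)     = ⊥-elim (Interior⇒¬Endpoint (∈A⇒Interior w k∈A) end)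
  heightAt-unique w (endpoint end)     (passes-above k∈A) = ⊥-elim (Interior⇒¬Endpoint (∈A⇒Interior w k∈A) end)
  heightAt-unique w (passes-below k∈B) (endpoint end)     = ⊥-elim (Interior⇒¬Endpoint (∈B⇒Interior w k∈B) end)
  heightAt-unique w (endpoint end)     (passes-below k∈B) = ⊥-elim (Interior⇒¬Endpoint (∈B⇒Interior w k∈B) end)
  heightAt-unique w (passes-above k∈A) (beyond out)       = ⊥-elim (InSpan⇒¬beyond (∈A⇒InSpan w k∈A) out)
  heightAt-unique w (beyond out)       (passes-above k∈A) = ⊥-elim (InSpan⇒¬beyond (∈A⇒InSpan w k∈A) out)
  heightAt-unique w (passes-below k∈B) (beyond out)       = ⊥-elim (InSpan⇒¬beyond (∈B⇒InSpan w k∈B) out)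
  heightAt-unique w (beyond out)       (passes-below k∈B) = ⊥-elim (InSpan⇒¬beyond (∈B⇒InSpan w k∈B) out)
  heightAt-unique w (endpoint end)     (beyond out)       = ⊥-elim (InSpan⇒¬beyond (Endpoint⇒InSpan w end) out)
  heightAt-unique w (beyond out)       (endpoint end)     = ⊥-elim (InSpan⇒¬beyond (Endpoint⇒InSpan w end) out)

  InSpan⇒≢off : InSpan a k → HeightAt a k h → h ≢ off
  InSpan⇒≢off a∋k (beyond out) refl = InSpan⇒¬beyond a∋k out

  data Above (a b : Arc n) (k : Pt n) : Set where
    A/B   : k ∈ A a → k ∈ B b → Above a b k
    end/B : Endpoint a k → k ∈ B b → Above a b k
    A/end : k ∈ A a → Endpoint b k → Above a b k

  Above⇒HalfCross : Above a b k → HalfCross a b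
  Above⇒HalfCross {k = k} (A/B k∈A k∈B)   = k , inj₁ (k∈A , k∈B)
  Above⇒HalfCross {k = k} (end/B end k∈B) = k , inj₂ (inj₁ (end , k∈B))
  Above⇒HalfCross {k = k} (A/end k∈A end) = k , inj₂ (inj₂ (k∈A , end))

  HalfCross⇒Above : (c : HalfCross a b) → Above a b (proj₁ c)
  HalfCross⇒Above (_ , inj₁ (k∈A , k∈B))         = A/B k∈A k∈B
  HalfCross⇒Above (_ , inj₂ (inj₁ (end , k∈B))) = end/B end k∈B
  HalfCross⇒Above (_ , inj₂ (inj₂ (k∈A , end))) = A/end k∈A end

  ≻⇒Above : HeightAt a k h → HeightAt b k h' → h ≻ h' → Above a b k
  ≻⇒Above (passes-above k∈A) (endpoint end)     hi≻mid = A/end k∈A end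
  ≻⇒Above (passes-above k∈A) (passes-below k∈B) hi≻lo  = A/B k∈A k∈B
  ≻⇒Above (endpoint end)     (passes-below k∈B) mid≻lo = end/B end k∈B

  Above⇒≻ : IsWigglyArc a → IsWigglyArc b → HeightAt a k h → HeightAt b k h' → Above a b k → h ≻ h'
  Above⇒≻ wa wb ha hb (A/B k∈A k∈B) =
    subst₂ _≻_ (heightAt-unique wa (passes-above k∈A) ha) (heightAt-unique wb (passes-below k∈B) hb) hi≻lo
  Above⇒≻ wa wb ha hb (end/B end k∈B) =
    subst₂ _≻_ (heightAt-unique wa (endpoint end) ha) (heightAt-unique wb (passes-below k∈B) hb) mid≻lo
  Above⇒≻ wa wb ha hb (A/end k∈A end) =
    subst₂ _≻_ (heightAt-unique wa (passes-above k∈A) ha) (heightAt-unique wb (endpoint end) hb) hi≻mid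

  Above-asym : IsWigglyArc a → IsWigglyArc b → Above a b k → ¬ Above b a k
  Above-asym {k = k} wa wb a>b b>a with heightAt wa k | heightAt wb k
  ... | _ , ha | _ , hb = ≻-asym (Above⇒≻ wa wb ha hb a>b) (Above⇒≻ wb wa hb ha b>a)

  Above-split : IsWigglyArc a → IsWigglyArc b → IsWigglyArc c →
                Above a b k → InSpan c k → Above a c k ⊎ Above c b k
  Above-split {k = k} wa wb wc a>b c∋k with heightAt wa k | heightAt wb k | heightAt wc k
  ... | _ , ha | _ , hb | hc' , hc =
    Sum.map (≻⇒Above ha hc) (≻⇒Above hc hb) (≻-cotrans (Above⇒≻ wa wb ha hb a>b) hc' (InSpan⇒≢off c∋k hc))

  Above⇒InSpanˡ : IsWigglyArc a → Above a b k → InSpan a k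
  Above⇒InSpanˡ wa (A/B k∈A _)   = ∈A⇒InSpan wa k∈A
  Above⇒InSpanˡ wa (end/B end _) = Endpoint⇒InSpan wa end
  Above⇒InSpanˡ wa (A/end k∈A _) = ∈A⇒InSpan wa k∈A

  Above⇒InSpanʳ : IsWigglyArc b → Above a b k → InSpan b k
  Above⇒InSpanʳ wb (A/B _ k∈B)   = ∈B⇒InSpan wb k∈B
  Above⇒InSpanʳ wb (end/B _ k∈B) = ∈B⇒InSpan wb k∈B
  Above⇒InSpanʳ wb (A/end _ end) = Endpoint⇒InSpan wb end

  Above-Interior : Interior a k → Interior b k → Above a b k → k ∈ A a × k ∈ B b
  Above-Interior _   _   (A/B k∈A k∈B) = k∈A , k∈B
  Above-Interior a∋k _   (end/B end _) = ⊥-elim (Interior⇒¬Endpoint a∋k end)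
  Above-Interior _   b∋k (A/end _ end) = ⊥-elim (Interior⇒¬Endpoint b∋k end)

  Compatible-sym : Compatible a b → Compatible b a
  Compatible-sym (¬pointed , ¬crossing) = ¬pointed ∘ Sum.swap , ¬crossing ∘ Product.swap

  Compatible-refl : IsWigglyArc a → Compatible a a
  Compatible-refl w = [ Fin.<⇒≢ (i<j w) , Fin.<⇒≢ (i<j w) ]′ , λ (c , _) →
    Above-asym w w (HalfCross⇒Above c) (HalfCross⇒Above c)

  Compatible-stable : ¬ ¬ Compatible a b → Compatible a b
  Compatible-stable ¬¬c = (λ pointed → ¬¬c λ c → proj₁ c pointed) , (λ crossing → ¬¬c λ c → proj₂ c crossing)

  Compatible-one-sided : Compatible a b → Above a b p → ¬ Above b a q
  Compatible-one-sided (_ , ¬crossing) a>b b>a = ¬crossing (Above⇒HalfCross a>b , Above⇒HalfCross b>a)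

  private
    lookup-interval : ∀ (s t k : Pt n) → Vec.lookup (interval s t) k ≡ does (s <? k) ∧ does (k <? t)
    lookup-interval s t = lookup∘tabulate (λ k → does (s <? k) ∧ does (k <? t))

  interval⁻ : k ∈ interval s t → s < k × k < t
  interval⁻ {k = k} {s = s} {t = t} k∈I
    with Equivalence.to (T-∧ {does (s <? k)})
           (Equivalence.from T-≡ (trans (sym (lookup-interval s t k)) ([]=⇒lookup k∈I)))
  ... | s<k , k<t = ℕ.<ᵇ⇒< (toℕ s) (toℕ k) s<k , ℕ.<ᵇ⇒< (toℕ k) (toℕ t) k<t

  interval⁺ : s < k → k < t → k ∈ interval s t
  interval⁺ {s = s} {k = k} {t = t} s<k k<t = lookup⇒[]= k (interval s t)
    (trans (lookup-interval s t k)
           (Equivalence.to T-≡ (Equivalence.from (T-∧ {does (s <? k)}) (ℕ.<⇒<ᵇ s<k , ℕ.<⇒<ᵇ k<t))))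

  prefix : Arc n → Pt n → Arc n
  prefix a t = arc (i a) t (A a ∩ interval (i a) t) (B a ∩ interval (i a) t)

  prefix-wiggly : IsWigglyArc a → i a < t → t ≤ j a → IsWigglyArc (prefix a t)
  prefix-wiggly {a = a} {t = t} w i<t t≤j = i<t , (λ k → mk⇔ (restricted k) (extended k)) , disjoint
    where
    restricted : ∀ k → k ∈ A (prefix a t) ⊎ k ∈ B (prefix a t) → i a < k × k < t
    restricted k (inj₁ k∈A) = interval⁻ (proj₂ (x∈p∩q⁻ _ _ k∈A))
    restricted k (inj₂ k∈B) = interval⁻ (proj₂ (x∈p∩q⁻ _ _ k∈B))

    extended : ∀ k → i a < k × k < t → k ∈ A (prefix a t) ⊎ k ∈ B (prefix a t)
    extended k (i<k , k<t) = Sum.map (λ k∈A → x∈p∩q⁺ (k∈A , k∈I)) (λ k∈B → x∈p∩q⁺ (k∈B , k∈I))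
                                     (Interior⇒∈A⊎∈B w (interior i<k (ℕ.<-≤-trans k<t t≤j)))
      where k∈I = interval⁺ i<k k<t

    disjoint : ∀ k → ¬ (k ∈ A (prefix a t) × k ∈ B (prefix a t))
    disjoint k (k∈A , k∈B) = ∈A⇒∉B w (proj₁ (x∈p∩q⁻ _ _ k∈A)) (proj₁ (x∈p∩q⁻ _ _ k∈B))

  prefix-Above⁺ : IsWigglyArc a → t ≤ j a → k < t → Above a b k → Above (prefix a t) b k
  prefix-Above⁺ w _ k<t (A/B k∈A k∈B) = A/B (x∈p∩q⁺ (k∈A , interval⁺ (start<k (∈A⇒Interior w k∈A)) k<t)) k∈B
  prefix-Above⁺ w _ k<t (A/end k∈A end) = A/end (x∈p∩q⁺ (k∈A , interval⁺ (start<k (∈A⇒Interior w k∈A)) k<t)) end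
  prefix-Above⁺ _ _ _ (end/B (inj₁ k≡i) k∈B) = end/B (inj₁ k≡i) k∈B
  prefix-Above⁺ _ t≤j k<t (end/B (inj₂ refl) _) = ⊥-elim (ℕ.<-irrefl refl (ℕ.<-≤-trans k<t t≤j))

  prefix-Above⁻ : Above (prefix a t) b k → Above a b k ⊎ t ∈ B b
  prefix-Above⁻ (A/B k∈A k∈B)           = inj₁ (A/B (proj₁ (x∈p∩q⁻ _ _ k∈A)) k∈B)
  prefix-Above⁻ (A/end k∈A end)         = inj₁ (A/end (proj₁ (x∈p∩q⁻ _ _ k∈A)) end)
  prefix-Above⁻ (end/B (inj₁ k≡i) k∈B)  = inj₁ (end/B (inj₁ k≡i) k∈B)
  prefix-Above⁻ (end/B (inj₂ refl) t∈B) = inj₂ t∈B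

  Above-prefix⁻ : Above b (prefix a t) k → Above b a k ⊎ t ∈ A b
  Above-prefix⁻ (A/B k∈A k∈B)           = inj₁ (A/B k∈A (proj₁ (x∈p∩q⁻ _ _ k∈B)))
  Above-prefix⁻ (end/B end k∈B)         = inj₁ (end/B end (proj₁ (x∈p∩q⁻ _ _ k∈B)))
  Above-prefix⁻ (A/end k∈A (inj₁ k≡i))  = inj₁ (A/end k∈A (inj₁ k≡i))
  Above-prefix⁻ (A/end t∈A (inj₂ refl)) = inj₂ t∈A

  prefix-Compatible : IsWigglyArc a → i a < t → Compatible (prefix a t) a
  prefix-Compatible {a = a} {t = t} w i<t = [ Fin.<⇒≢ (i<j w) , Fin.<⇒≢ i<t ]′ , λ (pa>a , a>pa) →
    one-sided (prefix-Above⁻ (HalfCross⇒Above pa>a)) (Above-prefix⁻ (HalfCross⇒Above a>pa))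
    where
    one-sided : ∀ {k ℓ} → Above a a k ⊎ t ∈ B a → ¬ (Above a a ℓ ⊎ t ∈ A a)
    one-sided (inj₁ a>a) _          = Above-asym w w a>a a>a
    one-sided _ (inj₁ a>a)          = Above-asym w w a>a a>a
    one-sided (inj₂ t∈B) (inj₂ t∈A) = ∈A⇒∉B w t∈A t∈B

  start-Interior : Compatible γ a → k < i γ → InSpan a k → InSpan a p → InSpan γ p → Interior a (i γ)
  start-Interior γ∼a k<iγ a∋k a∋p γ∋p =
    interior (ℕ.≤-<-trans (start≤k a∋k) k<iγ) (Fin.≤∧≢⇒< (ℕ.≤-trans (start≤k γ∋p) (k≤end a∋p)) (proj₁ γ∼a ∘ inj₁))

  end-Interior : Compatible γ a → j γ < k → InSpan a k → InSpan a p → InSpan γ p → Interior a (j γ)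
  end-Interior γ∼a jγ<k a∋k a∋p γ∋p =
    interior (Fin.≤∧≢⇒< (ℕ.≤-trans (start≤k a∋p) (k≤end γ∋p)) (proj₁ γ∼a ∘ inj₂)) (ℕ.<-≤-trans jγ<k (k≤end a∋k))

  Endpoint-below : IsWigglyArc a → Compatible γ a → Above γ a p → Endpoint γ k → Interior a k → k ∈ B a
  Endpoint-below wa γ∼a γ>a end a∋k =
    [ (λ k∈A → ⊥-elim (Compatible-one-sided γ∼a γ>a (A/end k∈A end))) , id ]′ (Interior⇒∈A⊎∈B wa a∋k)

  Endpoint-above : IsWigglyArc a → Compatible γ a → Above a γ p → Endpoint γ k → Interior a k → k ∈ A a
  Endpoint-above wa γ∼a a>γ end a∋k =
    [ id , (λ k∈B → ⊥-elim (Compatible-one-sided γ∼a (end/B end k∈B) a>γ)) ]′ (Interior⇒∈A⊎∈B wa a∋k)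

  separator-absent : IsWigglyArc P → IsWigglyArc Q → IsWigglyArc γ → Compatible γ P → Compatible γ Q →
                     Above γ P p → Above Q γ q → Above P Q k → ¬ InSpan γ k
  separator-absent wP wQ wγ γ∼P γ∼Q γ>P Q>γ P>Q γ∋k =
    [ Compatible-one-sided γ∼P γ>P , (λ γ>Q → Compatible-one-sided γ∼Q γ>Q Q>γ) ]′ (Above-split wP wQ wγ P>Q γ∋k)

  separator-endʳ : IsWigglyArc P → IsWigglyArc Q → IsWigglyArc γ → Compatible γ P → Compatible γ Q →
                   Above γ P p → Above Q γ q → Above P Q k → q ≤ k → j γ < k × Above Q P (j γ)
  separator-endʳ {P = P} {Q = Q} {γ = γ} {k = k} wP wQ wγ γ∼P γ∼Q γ>P Q>γ P>Q q≤k with k ≤? j γ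
  ... | yes k≤jγ = ⊥-elim (separator-absent wP wQ wγ γ∼P γ∼Q γ>P Q>γ P>Q
                            (inSpan (ℕ.≤-trans (start≤k (Above⇒InSpanʳ wγ Q>γ)) q≤k) k≤jγ))
  ... | no k≰jγ = jγ<k , A/B jγ∈A jγ∈B
    where
    jγ<k : j γ < k
    jγ<k = ℕ.≰⇒> k≰jγ
    jγ∈A : j γ ∈ A Q
    jγ∈A = Endpoint-above wQ γ∼Q Q>γ (inj₂ refl)
             (end-Interior γ∼Q jγ<k (Above⇒InSpanʳ wQ P>Q) (Above⇒InSpanˡ wQ Q>γ) (Above⇒InSpanʳ wγ Q>γ))
    jγ∈B : j γ ∈ B P
    jγ∈B = Endpoint-below wP γ∼P γ>P (inj₂ refl)
             (end-Interior γ∼P jγ<k (Above⇒InSpanˡ wP P>Q) (Above⇒InSpanʳ wP γ>P) (Above⇒InSpanˡ wγ γ>P))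

  separator-startˡ : IsWigglyArc P → IsWigglyArc Q → IsWigglyArc γ → Compatible γ P → Compatible γ Q →
                     Above γ P p → Above Q γ q → Above P Q k → k ≤ q → k < i γ × Above Q P (i γ)
  separator-startˡ {P = P} {Q = Q} {γ = γ} {k = k} wP wQ wγ γ∼P γ∼Q γ>P Q>γ P>Q k≤q with i γ ≤? k
  ... | yes iγ≤k = ⊥-elim (separator-absent wP wQ wγ γ∼P γ∼Q γ>P Q>γ P>Q
                            (inSpan iγ≤k (ℕ.≤-trans k≤q (k≤end (Above⇒InSpanʳ wγ Q>γ)))))
  ... | no iγ≰k = k<iγ , A/B iγ∈A iγ∈B
    where
    k<iγ : k < i γ
    k<iγ = ℕ.≰⇒> iγ≰k
    iγ∈A : i γ ∈ A Q
    iγ∈A = Endpoint-above wQ γ∼Q Q>γ (inj₁ refl)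
             (start-Interior γ∼Q k<iγ (Above⇒InSpanʳ wQ P>Q) (Above⇒InSpanˡ wQ Q>γ) (Above⇒InSpanʳ wγ Q>γ))
    iγ∈B : i γ ∈ B P
    iγ∈B = Endpoint-below wP γ∼P γ>P (inj₁ refl)
             (start-Interior γ∼P k<iγ (Above⇒InSpanˡ wP P>Q) (Above⇒InSpanʳ wP γ>P) (Above⇒InSpanˡ wγ γ>P))

  insert : ArcSet n → Arc n → ArcSet n
  insert T δ γ = T γ ⊎ γ ≡ δ

  Exchangeable-sym : Exchangeable P Q → Exchangeable Q P
  Exchangeable-sym (P≢Q , T , T' , T-pt , T'-pt , P∈T , Q∈T' , exchange) =
    P≢Q ∘ sym , T' , T , T'-pt , T-pt , Q∈T' , P∈T , ⇔-sym ∘ exchange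

  Exchangeable⇒Compatible : Exchangeable P Q → IsWigglyArc δ → Compatible δ P → δ ≢ P →
    (∀ γ → IsWigglyArc γ → Compatible γ P → Compatible γ Q → Compatible γ δ) → Compatible δ Q
  Exchangeable⇒Compatible {P = P} {Q = Q} {δ = δ}
    (_ , T , T' , ((wiggly , up , down , pairwise) , maximal) , ((_ , _ , _ , pairwise') , _) ,
     P∈T , Q∈T' , exchange)
    wδ δ∼P δ≢P universal = pairwise' δ Q (T⇒T' δ∈T δ≢P) Q∈T'
    where
    T⇒T' : ∀ {γ} → T γ → γ ≢ P → T' γ
    T⇒T' {γ} γ∈T γ≢P = proj₁ (Equivalence.to (exchange γ) (γ∈T , γ≢P))

    T-Compatible : ∀ γ → T γ → Compatible γ δ
    T-Compatible γ γ∈T = Compatible-stable λ ¬γ∼δ → ¬¬-excluded-middle {A = γ ≡ P} λ where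
      (yes refl) → ¬γ∼δ (Compatible-sym δ∼P)
      (no γ≢P)   → ¬γ∼δ (universal γ (wiggly γ γ∈T) (pairwise γ P γ∈T P∈T) (pairwise' γ Q (T⇒T' γ∈T γ≢P) Q∈T'))

    insert-wiggly : ∀ γ → insert T δ γ → IsWigglyArc γ
    insert-wiggly γ (inj₁ γ∈T) = wiggly γ γ∈T
    insert-wiggly γ (inj₂ refl) = wδ

    insert-pairwise : PairwiseCompatible (insert T δ)
    insert-pairwise a b (inj₁ a∈T)  (inj₁ b∈T)  = pairwise a b a∈T b∈T
    insert-pairwise a b (inj₁ a∈T)  (inj₂ refl) = T-Compatible a a∈T
    insert-pairwise a b (inj₂ refl) (inj₁ b∈T)  = Compatible-sym (T-Compatible b b∈T)
    insert-pairwise a b (inj₂ refl) (inj₂ refl) = Compatible-refl wδ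

    δ∈T : T δ
    δ∈T = maximal (insert T δ) (insert-wiggly , inj₁ up , inj₁ down , insert-pairwise) (λ _ → inj₁)
                  δ (inj₂ refl)

  prefix-universal : IsWigglyArc P → IsWigglyArc Q → IsWigglyArc γ → Compatible γ P → Compatible γ Q →
    s ∈ A Q → s ∈ B P → s < t → Above P Q t → (∀ {u} → s < u → u < t → ¬ Above Q P u) →
    Compatible γ (prefix P s)
  prefix-universal {P = P} {Q = Q} {γ = γ} {s = s} wP wQ wγ γ∼P γ∼Q s∈A s∈B s<t P>Q none-between =
    non-pointed , no-crossing
    where
    continues : ∀ {p} → Above γ P p → Above Q γ s → ¬ s < j γ
    continues γ>P Q>γ s<jγ =
      let jγ<t , Q>P = separator-endʳ wP wQ wγ γ∼P γ∼Q γ>P Q>γ P>Q (ℕ.<⇒≤ s<t) in none-between s<jγ jγ<t Q>P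

    non-pointed : ¬ NonPointed γ (prefix P s)
    non-pointed (inj₁ iγ≡s) =
      continues (end/B (inj₁ (sym iγ≡s)) s∈B) (A/end s∈A (inj₁ (sym iγ≡s))) (subst (_< j γ) iγ≡s (i<j wγ))
    non-pointed (inj₂ iP≡jγ) = proj₁ γ∼P (inj₂ iP≡jγ)

    no-crossing : ¬ Crossing γ (prefix P s)
    no-crossing ((p , γ>cut) , (q , cut>γ)) =
      [ Compatible-one-sided γ∼P (proj₂ γ>P)
      , (λ s∈Bγ → continues (proj₂ γ>P) (A/B s∈A s∈Bγ) (k<end (∈B⇒Interior wγ s∈Bγ)))
      ]′ (prefix-Above⁻ (HalfCross⇒Above (q , cut>γ)))
      where
      γ>P : ∃ (Above γ P)
      γ>P = [ -,_ , (λ s∈Aγ → -, A/B s∈Aγ s∈B) ]′ (Above-prefix⁻ (HalfCross⇒Above (p , γ>cut)))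

  -- The recursion runs over s downwards from t, so for the cut at s there is no later Q-above-P point.
  Exchangeable⇒no-zigzag : IsWigglyArc P → IsWigglyArc Q → Exchangeable P Q →
    r < s → s < t → Above P Q r → Above Q P s → Above P Q t → ⊥
  Exchangeable⇒no-zigzag {P = P} {Q = Q} {r = r} {s = s} {t = t} wP wQ ex = zigzag (>-wellFounded s)
    where
    zigzag : ∀ {s} → Acc _>_ s → r < s → s < t → Above P Q r → Above Q P s → Above P Q t → ⊥
    zigzag {s} (acc later) r<s s<t P>Qʳ Q>Pˢ P>Qᵗ =
      ¬cut∼Q (Exchangeable⇒Compatible ex (prefix-wiggly wP (start<k P∋s) (ℕ.<⇒≤ (k<end P∋s)))
                                          (prefix-Compatible wP (start<k P∋s)) cut≢P
               λ γ wγ γ∼P γ∼Q → prefix-universal wP wQ wγ γ∼P γ∼Q s∈A s∈B s<t P>Qᵗ none-between)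
      where
      P∋s = InSpan⇒Interior (Above⇒InSpanˡ wP P>Qʳ) (Above⇒InSpanˡ wP P>Qᵗ) r<s s<t
      Q∋s = InSpan⇒Interior (Above⇒InSpanʳ wQ P>Qʳ) (Above⇒InSpanʳ wQ P>Qᵗ) r<s s<t
      s∈A = proj₁ (Above-Interior Q∋s P∋s Q>Pˢ)
      s∈B = proj₂ (Above-Interior Q∋s P∋s Q>Pˢ)

      cut≢P : prefix P s ≢ P
      cut≢P cut≡P = Fin.<⇒≢ (k<end P∋s) (cong j cut≡P)

      ¬cut∼Q : ¬ Compatible (prefix P s) Q
      ¬cut∼Q cut∼Q =
        Compatible-one-sided cut∼Q (prefix-Above⁺ wP (ℕ.<⇒≤ (k<end P∋s)) r<s P>Qʳ) (A/end s∈A (inj₂ refl))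

      none-between : ∀ {u} → s < u → u < t → ¬ Above Q P u
      none-between s<u u<t Q>Pᵘ = zigzag (later s<u) (ℕ.<-trans r<s s<u) u<t P>Qʳ Q>Pᵘ P>Qᵗ

  CrossesDownward : Arc n → Arc n → Set
  CrossesDownward a b = ∃₂ λ k ℓ → k < ℓ × Above a b k × Above b a ℓ

  Exchangeable-CrossesDownward-asym : IsWigglyArc α → IsWigglyArc α' → Exchangeable α α' →
    CrossesDownward α α' → ¬ CrossesDownward α' α
  Exchangeable-CrossesDownward-asym wα wα' ex (k , ℓ , k<ℓ , α>α'ᵏ , α'>αˡ) (r , s , r<s , α'>αʳ , α>α'ˢ)
    with Fin.<-cmp ℓ s
  ... | tri< ℓ<s _ _  = Exchangeable⇒no-zigzag wα wα' ex k<ℓ ℓ<s α>α'ᵏ α'>αˡ α>α'ˢ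
  ... | tri≈ _ refl _ = Above-asym wα' wα α'>αˡ α>α'ˢ
  ... | tri> _ _ s<ℓ  = Exchangeable⇒no-zigzag wα' wα (Exchangeable-sym ex) r<s s<ℓ α'>αʳ α>α'ˢ α'>αˡ

  CrossesNWSE⇒CrossesDownward : CrossesNWSE α α' → CrossesDownward α α'
  CrossesNWSE⇒CrossesDownward {α = α} {α' = α'} (k , ℓ , _ , k<ℓ , _ , west , east) =
    k , ℓ , k<ℓ , above-west west , above-east east
    where
    above-west : (k ∈ A α × k ∈ B α') ⊎ (k ≡ i α × k ∈ B α') ⊎ (k ∈ A α × k ≡ i α') → Above α α' k
    above-west (inj₁ (k∈A , k∈B))          = A/B k∈A k∈B
    above-west (inj₂ (inj₁ (k≡i , k∈B)))   = end/B (inj₁ k≡i) k∈B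
    above-west (inj₂ (inj₂ (k∈A , k≡i')))  = A/end k∈A (inj₁ k≡i')
    above-east : (ℓ ∈ A α' × ℓ ∈ B α) ⊎ (ℓ ≡ j α' × ℓ ∈ B α) ⊎ (ℓ ∈ A α' × ℓ ≡ j α) → Above α' α ℓ
    above-east (inj₁ (ℓ∈A , ℓ∈B))          = A/B ℓ∈A ℓ∈B
    above-east (inj₂ (inj₁ (ℓ≡j' , ℓ∈B)))  = end/B (inj₂ ℓ≡j') ℓ∈B
    above-east (inj₂ (inj₂ (ℓ∈A , ℓ≡j)))   = A/end ℓ∈A (inj₂ ℓ≡j)

  mirror : Arc n → Arc n
  mirror a = arc (i a) (j a) (B a) (A a)

  mirror-wiggly : IsWigglyArc a → IsWigglyArc (mirror a)
  mirror-wiggly (i<j , span , disjoint) =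
    i<j , (λ k → mk⇔ (Equivalence.to (span k) ∘ Sum.swap) (Sum.swap ∘ Equivalence.from (span k))) ,
    (λ k → disjoint k ∘ Product.swap)

  Above-mirror : Above a b k → Above (mirror b) (mirror a) k
  Above-mirror (A/B k∈A k∈B)   = A/B k∈B k∈A
  Above-mirror (end/B end k∈B) = A/end k∈B end
  Above-mirror (A/end k∈A end) = end/B end k∈A

  Compatible-mirror : Compatible a b → Compatible (mirror a) (mirror b)
  Compatible-mirror {a = a} {b = b} (¬pointed , ¬crossing) = ¬pointed , λ (ab , ba) →
    ¬crossing ( Above⇒HalfCross (Above-mirror (HalfCross⇒Above {a = mirror b} {b = mirror a} ba))
              , Above⇒HalfCross (Above-mirror (HalfCross⇒Above {a = mirror a} {b = mirror b} ab)))

  CrossesDownward-mirror : CrossesDownward a b → CrossesDownward (mirror b) (mirror a)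
  CrossesDownward-mirror (k , ℓ , k<ℓ , a>b , b>a) = k , ℓ , k<ℓ , Above-mirror a>b , Above-mirror b>a

  junction-¬Endpoint : Compatible γ α → Compatible γ α' → j α ≡ i α' → ¬ Endpoint γ (j α)
  junction-¬Endpoint γ∼α _    _    (inj₁ j≡iγ) = proj₁ γ∼α (inj₁ (sym j≡iγ))
  junction-¬Endpoint _   γ∼α' j≡i' (inj₂ j≡jγ) = proj₁ γ∼α' (inj₂ (trans (sym j≡i') j≡jγ))

  junction : IsWigglyArc γ → Compatible γ α → Compatible γ α' → j α ≡ i α' → InSpan γ (j α) →
    (Above γ α (j α) × Above γ α' (j α)) ⊎ (Above α γ (j α) × Above α' γ (j α))
  junction wγ γ∼α γ∼α' j≡i' (inSpan iγ≤j j≤jγ) =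
    Sum.map (λ j∈A → A/end j∈A (inj₂ refl) , A/end j∈A (inj₁ j≡i'))
            (λ j∈B → end/B (inj₂ refl) j∈B , end/B (inj₁ j≡i') j∈B)
            (Interior⇒∈A⊎∈B wγ (interior (Fin.≤∧≢⇒< iγ≤j (¬end ∘ inj₁ ∘ sym)) (Fin.≤∧≢⇒< j≤jγ (¬end ∘ inj₂))))
    where ¬end = junction-¬Endpoint γ∼α γ∼α' j≡i'

  private
    ∈Bβ₁⁻ : (α α' : Arc n) → k ∈ B (β₁ α α') → (k ∈ B α ⊎ k ∈ B α') ⊎ k ≡ j α
    ∈Bβ₁⁻ α α' k∈B = Sum.map (x∈p∪q⁻ (B α) (B α')) (x∈⁅y⁆⇒x≡y (j α)) (x∈p∪q⁻ (B α ∪ B α') ⁅ j α ⁆ k∈B)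

  Above-β₁ : Compatible γ α → Compatible γ α' → j α ≡ i α' → Above γ (β₁ α α') p → Above γ α p ⊎ Above γ α' p
  Above-β₁ {α = α} {α' = α'} _ _ _ (A/B p∈A p∈B) with ∈Bβ₁⁻ α α' p∈B
  ... | inj₁ p∈B∪B' = Sum.map (A/B p∈A) (A/B p∈A) p∈B∪B'
  ... | inj₂ p≡j    = inj₁ (A/end p∈A (inj₂ p≡j))
  Above-β₁ {α = α} {α' = α'} γ∼α γ∼α' j≡i' (end/B end p∈B) with ∈Bβ₁⁻ α α' p∈B
  ... | inj₁ p∈B∪B' = Sum.map (end/B end) (end/B end) p∈B∪B'
  ... | inj₂ refl   = ⊥-elim (junction-¬Endpoint γ∼α γ∼α' j≡i' end)
  Above-β₁ _ _ _ (A/end p∈A (inj₁ p≡i))  = inj₁ (A/end p∈A (inj₁ p≡i))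
  Above-β₁ _ _ _ (A/end p∈A (inj₂ p≡j')) = inj₂ (A/end p∈A (inj₂ p≡j'))

  β₁-Above : Above (β₁ α α') γ q → Above α γ q ⊎ Above α' γ q
  β₁-Above {α = α} {α' = α'} (A/B q∈A q∈B) =
    Sum.map (λ q∈Aα → A/B q∈Aα q∈B) (λ q∈Aα' → A/B q∈Aα' q∈B) (x∈p∪q⁻ (A α) (A α') q∈A)
  β₁-Above {α = α} {α' = α'} (A/end q∈A end) =
    Sum.map (λ q∈Aα → A/end q∈Aα end) (λ q∈Aα' → A/end q∈Aα' end) (x∈p∪q⁻ (A α) (A α') q∈A)
  β₁-Above (end/B (inj₁ q≡i) q∈B)  = inj₁ (end/B (inj₁ q≡i) q∈B)
  β₁-Above (end/B (inj₂ q≡j') q∈B) = inj₂ (end/B (inj₂ q≡j') q∈B)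

  β₁-Compatible : IsWigglyArc α → IsWigglyArc α' → IsWigglyArc γ → Compatible γ α → Compatible γ α' →
                  j α ≡ i α' → Compatible γ (β₁ α α')
  β₁-Compatible {α = α} {α' = α'} {γ = γ} wα wα' wγ γ∼α γ∼α' j≡i' = non-pointed , no-crossing
    where
    non-pointed : ¬ NonPointed γ (β₁ α α')
    non-pointed (inj₁ iγ≡j') = proj₁ γ∼α' (inj₁ iγ≡j')
    non-pointed (inj₂ i≡jγ)  = proj₁ γ∼α (inj₂ i≡jγ)

    over-junction : InSpan γ p → p ≤ j α → i α' ≤ q → InSpan γ q → InSpan γ (j α)
    over-junction γ∋p p≤j i'≤q γ∋q =
      inSpan (ℕ.≤-trans (start≤k γ∋p) p≤j) (subst (_≤ j γ) (sym j≡i') (ℕ.≤-trans i'≤q (k≤end γ∋q)))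

    no-crossing : ¬ Crossing γ (β₁ α α')
    no-crossing (γ>β , β>γ) with Above-β₁ γ∼α γ∼α' j≡i' (HalfCross⇒Above γ>β) | β₁-Above (HalfCross⇒Above β>γ)
    ... | inj₁ γ>α  | inj₁ α>γ  = Compatible-one-sided γ∼α γ>α α>γ
    ... | inj₂ γ>α' | inj₂ α'>γ = Compatible-one-sided γ∼α' γ>α' α'>γ
    ... | inj₁ γ>α  | inj₂ α'>γ =
      [ (λ (_ , γ>α'ʲ) → Compatible-one-sided γ∼α' γ>α'ʲ α'>γ)
      , (λ (α>γʲ , _)  → Compatible-one-sided γ∼α γ>α α>γʲ)
      ]′ (junction wγ γ∼α γ∼α' j≡i' (over-junction (Above⇒InSpanˡ wγ γ>α) (k≤end (Above⇒InSpanʳ wα γ>α))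
                                                  (start≤k (Above⇒InSpanˡ wα' α'>γ)) (Above⇒InSpanʳ wγ α'>γ)))
    ... | inj₂ γ>α' | inj₁ α>γ  =
      [ (λ (γ>αʲ , _)  → Compatible-one-sided γ∼α γ>αʲ α>γ)
      , (λ (_ , α'>γʲ) → Compatible-one-sided γ∼α' γ>α' α'>γʲ)
      ]′ (junction wγ γ∼α γ∼α' j≡i' (over-junction (Above⇒InSpanʳ wγ α>γ) (k≤end (Above⇒InSpanˡ wα α>γ))
                                                  (start≤k (Above⇒InSpanʳ wα' γ>α')) (Above⇒InSpanˡ wγ γ>α')))

  -- β₁' α α' is definitionally mirror (β₁ (mirror α) (mirror α')).
  β₁'-Compatible : IsWigglyArc α → IsWigglyArc α' → IsWigglyArc γ → Compatible γ α → Compatible γ α' →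
                   j α ≡ i α' → Compatible γ (β₁' α α')
  β₁'-Compatible wα wα' wγ γ∼α γ∼α' j≡i' = Compatible-mirror
    (β₁-Compatible (mirror-wiggly wα) (mirror-wiggly wα') (mirror-wiggly wγ)
                   (Compatible-mirror γ∼α) (Compatible-mirror γ∼α') j≡i')

  Above-β₂ : Above γ (β₂ α α') p → Above γ α p ⊎ Above γ α' p
  Above-β₂ {α = α} {α' = α'} (A/B p∈A p∈B) =
    Sum.map (A/B p∈A) (A/B p∈A) (x∈p∪q⁻ (B α) (B α') (proj₂ (x∈p∩q⁻ (interval (i α') (j α)) _ p∈B)))
  Above-β₂ {α = α} {α' = α'} (end/B end p∈B) =
    Sum.map (end/B end) (end/B end) (x∈p∪q⁻ (B α) (B α') (proj₂ (x∈p∩q⁻ (interval (i α') (j α)) _ p∈B)))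
  Above-β₂ (A/end p∈A (inj₁ p≡i')) = inj₂ (A/end p∈A (inj₁ p≡i'))
  Above-β₂ (A/end p∈A (inj₂ p≡j))  = inj₁ (A/end p∈A (inj₂ p≡j))

  private
    ∈Aβ₂⁻ : (α α' : Arc n) → k ∈ A (β₂ α α') → (i α' < k × k < j α) × k ∉ B α × k ∉ B α'
    ∈Aβ₂⁻ α α' k∈A with x∈p∩q⁻ (interval (i α') (j α)) (∁ (B α ∪ B α')) k∈A
    ... | k∈I , k∈∁ =
      interval⁻ {s = i α'} {t = j α} k∈I , x∈∁p⇒x∉p k∈∁ ∘ x∈p∪q⁺ ∘ inj₁ , x∈∁p⇒x∉p k∈∁ ∘ x∈p∪q⁺ ∘ inj₂

  ∈Aβ₂⇒∈Aˡ : IsWigglyArc α → IsWigglyArc α' → i α < j α' → k ∈ A (β₂ α α') → k ∈ A α ⊎ (k ∈ A α' × k ≤ i α)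
  ∈Aβ₂⇒∈Aˡ {α = α} {α' = α'} {k = k} wα wα' iα<jα' k∈A with ∈Aβ₂⁻ α α' k∈A | i α <? k
  ... | (_ , k<jα) , k∉Bα , _  | yes iα<k = inj₁ (∉B⇒∈A wα (interior iα<k k<jα) k∉Bα)
  ... | (i'<k , _) , _ , k∉Bα' | no iα≮k  =
    inj₂ (∉B⇒∈A wα' (interior i'<k (ℕ.≤-<-trans (ℕ.≮⇒≥ iα≮k) iα<jα')) k∉Bα' , ℕ.≮⇒≥ iα≮k)

  ∈Aβ₂⇒∈Aʳ : IsWigglyArc α → IsWigglyArc α' → i α < j α' → k ∈ A (β₂ α α') → k ∈ A α' ⊎ (k ∈ A α × j α' ≤ k)
  ∈Aβ₂⇒∈Aʳ {α = α} {α' = α'} {k = k} wα wα' iα<jα' k∈A with ∈Aβ₂⁻ α α' k∈A | k <? j α'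
  ... | (i'<k , _) , _ , k∉Bα' | yes k<jα' = inj₁ (∉B⇒∈A wα' (interior i'<k k<jα') k∉Bα')
  ... | (_ , k<jα) , k∉Bα , _  | no k≮jα'  =
    inj₂ (∉B⇒∈A wα (interior (ℕ.<-≤-trans iα<jα' (ℕ.≮⇒≥ k≮jα')) k<jα) k∉Bα , ℕ.≮⇒≥ k≮jα')

  β₂-Aboveˡ : IsWigglyArc α → IsWigglyArc α' → i α < j α' → Above (β₂ α α') γ q →
              Above α γ q ⊎ (Above α' γ q × (q ≤ i α ⊎ q ≤ i α'))
  β₂-Aboveˡ wα wα' iα<jα' (A/B q∈A q∈B) =
    Sum.map (λ q∈Aα → A/B q∈Aα q∈B) (Product.map (λ q∈Aα' → A/B q∈Aα' q∈B) inj₁) (∈Aβ₂⇒∈Aˡ wα wα' iα<jα' q∈A)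
  β₂-Aboveˡ wα wα' iα<jα' (A/end q∈A end) =
    Sum.map (λ q∈Aα → A/end q∈Aα end) (Product.map (λ q∈Aα' → A/end q∈Aα' end) inj₁) (∈Aβ₂⇒∈Aˡ wα wα' iα<jα' q∈A)
  β₂-Aboveˡ _ _ _ (end/B (inj₁ q≡i') q∈B) = inj₂ (end/B (inj₁ q≡i') q∈B , inj₂ (Fin.≤-reflexive q≡i'))
  β₂-Aboveˡ _ _ _ (end/B (inj₂ q≡j) q∈B)  = inj₁ (end/B (inj₂ q≡j) q∈B)

  β₂-Aboveʳ : IsWigglyArc α → IsWigglyArc α' → i α < j α' → Above (β₂ α α') γ q →
              Above α' γ q ⊎ (Above α γ q × (j α ≤ q ⊎ j α' ≤ q))
  β₂-Aboveʳ wα wα' iα<jα' (A/B q∈A q∈B) =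
    Sum.map (λ q∈Aα' → A/B q∈Aα' q∈B) (Product.map (λ q∈Aα → A/B q∈Aα q∈B) inj₂) (∈Aβ₂⇒∈Aʳ wα wα' iα<jα' q∈A)
  β₂-Aboveʳ wα wα' iα<jα' (A/end q∈A end) =
    Sum.map (λ q∈Aα' → A/end q∈Aα' end) (Product.map (λ q∈Aα → A/end q∈Aα end) inj₂) (∈Aβ₂⇒∈Aʳ wα wα' iα<jα' q∈A)
  β₂-Aboveʳ _ _ _ (end/B (inj₁ q≡i') q∈B) = inj₁ (end/B (inj₁ q≡i') q∈B)
  β₂-Aboveʳ _ _ _ (end/B (inj₂ q≡j) q∈B)  = inj₂ (end/B (inj₂ q≡j) q∈B , inj₁ (Fin.≤-reflexive (sym q≡j)))

  β₂-Compatible : IsWigglyArc α → IsWigglyArc α' → IsWigglyArc γ → Compatible γ α → Compatible γ α' →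
                  CrossesDownward α α' → ¬ CrossesDownward α' α → Compatible γ (β₂ α α')
  β₂-Compatible {α = α} {α' = α'} {γ = γ} wα wα' wγ γ∼α γ∼α' (k , ℓ , k<ℓ , α>α'ᵏ , α'>αˡ) ¬α'↘α =
    non-pointed , no-crossing
    where
    α∋k  = Above⇒InSpanˡ wα α>α'ᵏ
    α'∋k = Above⇒InSpanʳ wα' α>α'ᵏ
    α'∋ℓ = Above⇒InSpanˡ wα' α'>αˡ
    α∋ℓ  = Above⇒InSpanʳ wα α'>αˡ

    iα<jα' : i α < j α'
    iα<jα' = ℕ.≤-<-trans (start≤k α∋k) (ℕ.<-≤-trans k<ℓ (k≤end α'∋ℓ))

    non-pointed : ¬ NonPointed γ (β₂ α α')
    non-pointed (inj₁ iγ≡jα)  = proj₁ γ∼α (inj₁ iγ≡jα)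
    non-pointed (inj₂ iα'≡jγ) = proj₁ γ∼α' (inj₂ iα'≡jγ)

    ≤k : q ≤ i α ⊎ q ≤ i α' → q ≤ k
    ≤k = [ (λ q≤iα → ℕ.≤-trans q≤iα (start≤k α∋k)) , (λ q≤iα' → ℕ.≤-trans q≤iα' (start≤k α'∋k)) ]′

    ℓ≤ : j α ≤ q ⊎ j α' ≤ q → ℓ ≤ q
    ℓ≤ = [ (λ jα≤q → ℕ.≤-trans (k≤end α∋ℓ) jα≤q) , (λ jα'≤q → ℕ.≤-trans (k≤end α'∋ℓ) jα'≤q) ]′

    above-α : Above γ α p → Above α' γ q → q ≤ i α ⊎ q ≤ i α' → ⊥
    above-α γ>α α'>γ q≤i =
      let jγ<k , α'>αʲ = separator-endʳ wα wα' wγ γ∼α γ∼α' γ>α α'>γ α>α'ᵏ (≤k q≤i)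
      in ¬α'↘α (j γ , k , jγ<k , α'>αʲ , α>α'ᵏ)

    above-α' : Above γ α' p → Above α γ q → j α ≤ q ⊎ j α' ≤ q → ⊥
    above-α' γ>α' α>γ j≤q =
      let ℓ<iγ , α>α'ⁱ = separator-startˡ wα' wα wγ γ∼α' γ∼α γ>α' α>γ α'>αˡ (ℓ≤ j≤q)
      in ¬α'↘α (ℓ , i γ , ℓ<iγ , α'>αˡ , α>α'ⁱ)

    no-crossing : ¬ Crossing γ (β₂ α α')
    no-crossing (γ>β , β>γ) with Above-β₂ (HalfCross⇒Above γ>β)
    ... | inj₁ γ>α  = [ Compatible-one-sided γ∼α γ>α , (λ (α'>γ , q≤i) → above-α γ>α α'>γ q≤i) ]′
                        (β₂-Aboveˡ wα wα' iα<jα' (HalfCross⇒Above β>γ))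
    ... | inj₂ γ>α' = [ Compatible-one-sided γ∼α' γ>α' , (λ (α>γ , j≤q) → above-α' γ>α' α>γ j≤q) ]′
                        (β₂-Aboveʳ wα wα' iα<jα' (HalfCross⇒Above β>γ))

  mirror-β₂' : (α α' : Arc n) → mirror (β₂' α α') ≡ β₂ (mirror α') (mirror α)
  mirror-β₂' α α' = cong (λ U → arc (i α) (j α') (J ∩ ∁ U) (J ∩ U)) (∪-comm (A α) (A α'))
    where J = interval (i α) (j α')

  β₂'-Compatible : IsWigglyArc α → IsWigglyArc α' → IsWigglyArc γ → Compatible γ α → Compatible γ α' →
                   CrossesDownward α α' → ¬ CrossesDownward α' α → Compatible γ (β₂' α α')
  β₂'-Compatible {α = α} {α' = α'} {γ = γ} wα wα' wγ γ∼α γ∼α' α↘α' ¬α'↘α =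
    Compatible-mirror (subst (Compatible (mirror γ)) (sym (mirror-β₂' α α'))
      (β₂-Compatible (mirror-wiggly wα') (mirror-wiggly wα) (mirror-wiggly wγ)
                     (Compatible-mirror γ∼α') (Compatible-mirror γ∼α)
                     (CrossesDownward-mirror α↘α') (¬α'↘α ∘ CrossesDownward-mirror)))

open WigglyArcs

open import Data.Nat using (ℕ; _≤_)
open import Data.Product using (_×_)
open import Relation.Binary.PropositionalEquality using (_≡_)

proposition2p20 : (n : ℕ) → 1 ≤ n → (α α' : Arc n) →
    IsWigglyArc α → IsWigglyArc α' → Exchangeable α α' →
    (∀ γ → IsWigglyArc γ → Compatible γ α → Compatible γ α' →
      (NonPointed α α' → j α ≡ i α' →
        Compatible γ (β₁ α α') × Compatible γ (β₁' α α')) ×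
      (Crossing α α' → CrossesNWSE α α' →
        Compatible γ (β₂ α α') × Compatible γ (β₂' α α')))
proposition2p20 n _ α α' wα wα' ex γ wγ γ∼α γ∼α' = non-pointed , crossing
  where
  non-pointed : NonPointed α α' → j α ≡ i α' → Compatible γ (β₁ α α') × Compatible γ (β₁' α α')
  non-pointed _ j≡i' = β₁-Compatible wα wα' wγ γ∼α γ∼α' j≡i' , β₁'-Compatible wα wα' wγ γ∼α γ∼α' j≡i'

  crossing : Crossing α α' → CrossesNWSE α α' → Compatible γ (β₂ α α') × Compatible γ (β₂' α α')
  crossing _ nwse =
    β₂-Compatible wα wα' wγ γ∼α γ∼α' α↘α' ¬α'↘α , β₂'-Compatible wα wα' wγ γ∼α γ∼α' α↘α' ¬α'↘α
    where
    α↘α' = CrossesNWSE⇒CrossesDownward nwse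
    ¬α'↘α = Exchangeable-CrossesDownward-asym wα wα' ex α↘α'
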